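{- Let $n\geqslant 3$ and let $S=\{\alpha^i,\alpha^{ -i},\beta\alpha^j,\beta\alpha^k\}\subseteq D_{2n}$, where $1\leqslant i\leqslant n-1$, $1\leqslant j<k\leqslant n-1$ and $\gcd(i,n)=\gcd(k-j,n)=1$. Then the Cayley graph $Cay(D_{2n},S)$ has a Hamilton decomposition, i.e. its edge set can be partitioned into two Hamilton cycles.
   Context: For $n\geqslant 2$, the dihedral group $D_{2n}$ is the group generated by two elements $\alpha,\beta$ subject to $\alpha^n=\beta^2=1$ and $\beta\alpha\beta=\alpha^{ -1}$. For a group $G$ and a subset $S\subseteq G$ with $1\notin S$, $S=S^{ -1}$ and $\langle S\rangle=G$, the Cayley graph $Cay(G,S)$ is the simple graph with vertex set $G$ in which $g,h\in G$ are adjacent iff $hg^{ -1}\in S$; it is regular of valency $|S|$. A regular graph of valency $2k$ has a Hamilton decomposition if its edge set can be partitioned into $k$ Hamilton cycles. -}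

module Defs where

open import Data.Bool using (Bool; true; false; if_then_else_; _xor_)
open import Data.Nat using (ℕ; suc; _+_; _∸_; NonZero)
open import Data.Nat.DivMod using (_mod_)
open import Data.Fin using (Fin; toℕ)
open import Data.Product using (_×_; _,_; ∃-syntax; Σ)
open import Data.Sum using (_⊎_)
open import Relation.Binary.PropositionalEquality using (_≡_)
open import Relation.Nullary using (¬_)
open import Function.Definitions using (Injective; Surjective)

-- The dihedral group D_{2n} = ⟨ α, β | α^n = β^2 = 1, βαβ = α^{-1} ⟩,
-- concretely: the element (b , a) stands for β^b α^a  (b ∈ {0,1}, a ∈ Z/n).

D : ℕ → Set
D n = Bool × Fin n

module _ {n : ℕ} .{{_ : NonZero n}} where

  negℤn : Fin n → Fin n
  negℤn a = (n ∸ toℕ a) mod n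

  addℤn : Fin n → Fin n → Fin n
  addℤn a d = (toℕ a + toℕ d) mod n

  -- (β^b α^a)(β^c α^d) = β^(b+c) α^((-1)^c a + d)
  _·_ : D n → D n → D n
  (b , a) · (c , d) = (b xor c) , addℤn (if c then negℤn a else a) d

  _⁻¹ : D n → D n
  (false , a) ⁻¹ = false , negℤn a
  (true  , a) ⁻¹ = true  , a

  α^ : ℕ → D n
  α^ m = false , m mod n

  βα^ : ℕ → D n
  βα^ m = true , m mod n

  α^- : ℕ → D n
  α^- m = (α^ m) ⁻¹

  S : ℕ → ℕ → ℕ → D n → Set
  S i j k x = x ≡ α^ i ⊎ x ≡ α^- i ⊎ x ≡ βα^ j ⊎ x ≡ βα^ k

  CayAdj : ℕ → ℕ → ℕ → D n → D n → Set
  CayAdj i j k g h = S i j k (h · (g ⁻¹))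

next : ∀ {N} → Fin N → Fin N
next {suc m} t = suc (toℕ t) mod suc m

record HamiltonCycle {V : Set} (N : ℕ) (Adj : V → V → Set) : Set where
  field
    vert     : Fin N → V
    injective  : Injective _≡_ _≡_ vert
    surjective : Surjective _≡_ _≡_ vert
    adjacent : ∀ t → Adj (vert t) (vert (next t))

open HamiltonCycle public

EdgeOf : ∀ {V : Set} {N : ℕ} {Adj : V → V → Set} →
         HamiltonCycle N Adj → V → V → Set
EdgeOf C g h = ∃[ t ] ((vert C t ≡ g × vert C (next t) ≡ h)
                     ⊎ (vert C t ≡ h × vert C (next t) ≡ g))

-- A Hamilton decomposition into two Hamilton cycles (valency 4): every edge
-- of the graph lies in exactly one of the two cycles (and, by the definition
-- of HamiltonCycle, every edge of each cycle is an edge of the graph).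
HamiltonDecomposition₂ : ∀ {V : Set} (N : ℕ) (Adj : V → V → Set) → Set
HamiltonDecomposition₂ {V} N Adj =
  Σ (HamiltonCycle N Adj) λ C₁ → Σ (HamiltonCycle N Adj) λ C₂ →
    (∀ (g h : V) → Adj g h →
       (EdgeOf {Adj = Adj} C₁ g h ⊎ EdgeOf {Adj = Adj} C₂ g h)
       × ¬ (EdgeOf {Adj = Adj} C₁ g h × EdgeOf {Adj = Adj} C₂ g h))

-- Write F z and T z for the vertices α^z and βα^z (z taken modulo n), I, J, K for i, j, k,
-- and Δ = k − j.
-- The β-edges form a Hamilton cycle H = F 0, T K, F Δ, T (K + Δ), F 2Δ, …, since Δ is a unit
-- modulo n; consecutive vertices differ by K and J alternately.  Since i is a unit, the
-- α-edges form an n-cycle on the F-vertices and another on the T-vertices.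
-- Cycle B runs F I, F 2I, …, F nI = F 0, T J, T (J − I), …, T (J + I) and back to F I: it takes
-- every α-edge except {F 0, F I} and {T J, T (I + J)}, and the β-edges {F 0, T J} and
-- {F I, T (I + J)}.  These two β-edges are the steps 2n − 1 → 0 and 2s − 1 → 2s of H, where
-- s Δ = I, so reversing the first 2s vertices of H exchanges them for the two missing α-edges;
-- this is cycle A.  The two cycles are disjoint because every edge of A, and no edge of B,
-- satisfies the predicate InA, and every edge of the Cayley graph lies on one of them.
module Submission where

open import Data.Bool using (Bool; true; false; _xor_)
open import Data.Empty using (⊥; ⊥-elim)
open import Data.Fin using (Fin; toℕ; fromℕ<; fromℕ)
import Data.Fin.Properties as Finₚ
open import Data.Nat as ℕ using (ℕ; zero; suc; NonZero; z≤n; s≤s)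
import Data.Nat.Properties as ℕₚ
open import Data.Nat.GCD using (gcd)
open import Data.Product using (Σ; ∃-syntax; _,_; _×_; proj₁; proj₂)
open import Data.Sum using (_⊎_; inj₁; inj₂; [_,_]′)
open import Function using (_∘_)
open import Relation.Nullary using (¬_; Dec; yes; no)
open import Relation.Binary.PropositionalEquality hiding ([_]; J)
open import Defs

module Enumerations where

  open import Data.Nat using (_+_; _∸_; _<_; _≤_)
  open import Data.Nat.DivMod using (m<n⇒m%n≡m; n%n≡0)
  open import Relation.Binary.Definitions using (tri<; tri≈; tri>)

  record Enumeration (V : Set) (N : ℕ) : Set where
    field
      at       : ℕ → V
      index    : V → ℕ
      index<   : ∀ v → index v < N
      at-index : ∀ v → at (index v) ≡ v
      index-at : ∀ {p} → p < N → index (at p) ≡ p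

  toℕ-next : ∀ {M} (t : Fin (suc M)) → suc (toℕ t) < suc M → toℕ (next t) ≡ suc (toℕ t)
  toℕ-next t t+1<M+1 = trans (Finₚ.toℕ-fromℕ< _) (m<n⇒m%n≡m t+1<M+1)

  toℕ-next-last : ∀ {M} (t : Fin (suc M)) → toℕ t ≡ M → toℕ (next t) ≡ 0
  toℕ-next-last {M} t t≡M =
    trans (Finₚ.toℕ-fromℕ< _) (trans (cong (λ x → suc x ℕ.% suc M) t≡M) (n%n≡0 (suc M)))

  EdgeOf-sym : ∀ {V : Set} {N} {Adj : V → V → Set} {C : HamiltonCycle N Adj} {g h} →
               EdgeOf C g h → EdgeOf C h g
  EdgeOf-sym (t , inj₁ e) = t , inj₂ e
  EdgeOf-sym (t , inj₂ e) = t , inj₁ e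

  module EnumeratedCycle {V : Set} {Adj : V → V → Set} {M : ℕ} (E : Enumeration V (suc M))
    (step : ∀ p → suc p < suc M → Adj (Enumeration.at E p) (Enumeration.at E (suc p)))
    (wrap : Adj (Enumeration.at E M) (Enumeration.at E 0)) where

    open Enumeration E

    private
      edge-at : (P : V → V → Set) → (∀ p → suc p < suc M → P (at p) (at (suc p))) → P (at M) (at 0) →
                ∀ t → P (at (toℕ t)) (at (toℕ (next t)))
      edge-at P step wrap t with suc (toℕ t) ℕₚ.<? suc M
      ... | yes t+1<M+1 = subst (P (at (toℕ t)) ∘ at) (sym (toℕ-next t t+1<M+1)) (step (toℕ t) t+1<M+1)
      ... | no  t+1≮M+1 = subst₂ (λ p q → P (at p) (at q)) (sym t≡M) (sym (toℕ-next-last t t≡M)) wrap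
        where
        t≡M : toℕ t ≡ M
        t≡M = ℕₚ.≤-antisym (ℕₚ.≤-pred (Finₚ.toℕ<n t)) (ℕₚ.≤-pred (ℕₚ.≮⇒≥ t+1≮M+1))

    cycle : HamiltonCycle (suc M) Adj
    cycle = record
      { vert       = at ∘ toℕ
      ; injective  = λ {s} {t} eq → Finₚ.toℕ-injective
          (trans (sym (index-at (Finₚ.toℕ<n s))) (trans (cong index eq) (index-at (Finₚ.toℕ<n t))))
      ; surjective = λ v → fromℕ< (index< v) ,
          λ eq → trans (cong at (trans (cong toℕ eq) (Finₚ.toℕ-fromℕ< _))) (at-index v)
      ; adjacent   = edge-at Adj step wrap
      }

    step-edge : ∀ {p} → suc p < suc M → EdgeOf cycle (at p) (at (suc p))
    step-edge {p} p+1<M+1 = t , inj₁ (cong at t≡p , cong at (trans (toℕ-next t t+1<M+1) (cong suc t≡p)))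
      where
      t = fromℕ< (ℕₚ.<-trans (ℕₚ.n<1+n p) p+1<M+1)
      t≡p = Finₚ.toℕ-fromℕ< _
      t+1<M+1 = subst (λ q → suc q < suc M) (sym t≡p) p+1<M+1

    wrap-edge : EdgeOf cycle (at M) (at 0)
    wrap-edge = fromℕ M , inj₁ (cong at M≡M , cong at (toℕ-next-last (fromℕ M) M≡M))
      where
      M≡M = Finₚ.toℕ-fromℕ M

    edges-satisfy : (P : V → V → Set) → (∀ g h → P g h → P h g) →
                    (∀ p → suc p < suc M → P (at p) (at (suc p))) → P (at M) (at 0) →
                    ∀ {g h} → EdgeOf cycle g h → P g h
    edges-satisfy P P-sym step wrap (t , inj₁ (refl , refl)) = edge-at P step wrap t
    edges-satisfy P P-sym step wrap (t , inj₂ (refl , refl)) = P-sym _ _ (edge-at P step wrap t)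

  resize : ∀ {V N N′} → N ≡ N′ → Enumeration V N → Enumeration V N′
  resize N≡N′ E = record
    { at       = at
    ; index    = index
    ; index<   = λ v → subst (index v <_) N≡N′ (index< v)
    ; at-index = at-index
    ; index-at = λ {p} p<N′ → index-at (subst (p <_) (sym N≡N′) p<N′)
    }
    where open Enumeration E

  module _ {A : Set} where

    prefixed : ℕ → (ℕ → A) → (ℕ → A) → ℕ → A
    prefixed zero    f g p       = g p
    prefixed (suc n) f g zero    = f zero
    prefixed (suc n) f g (suc p) = prefixed n (f ∘ suc) g p

    prefixed-< : ∀ n f g {p} → p < n → prefixed n f g p ≡ f p
    prefixed-< (suc n) f g {zero}  _         = refl
    prefixed-< (suc n) f g {suc p} (s≤s p<n) = prefixed-< n (f ∘ suc) g p<n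

    prefixed-+ : ∀ n f g p → prefixed n f g (n + p) ≡ g p
    prefixed-+ zero    f g p = refl
    prefixed-+ (suc n) f g p = prefixed-+ n (f ∘ suc) g p

    prefixed-steps : (R : A → A → Set) → ∀ n n′ f g →
                     (∀ t → suc t < suc n → R (f t) (f (suc t))) → R (f n) (g 0) →
                     (∀ t → suc t < n′ → R (g t) (g (suc t))) →
                     ∀ p → suc p < suc n + n′ → R (prefixed (suc n) f g p) (prefixed (suc n) f g (suc p))
    prefixed-steps R zero    n′ f g f-step junction g-step zero    _               = junction
    prefixed-steps R zero    n′ f g f-step junction g-step (suc p) (s≤s p+2<1+n′) = g-step p p+2<1+n′
    prefixed-steps R (suc n) n′ f g f-step junction g-step zero    _               = f-step 0 (s≤s (s≤s z≤n))
    prefixed-steps R (suc n) n′ f g f-step junction g-step (suc p) (s≤s p+2<n+n′) =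
      prefixed-steps R n n′ (f ∘ suc) g (λ t → f-step (suc t) ∘ s≤s) junction g-step p p+2<n+n′

    alternate : (ℕ → A) → (ℕ → A) → ℕ → A
    alternate f g zero    = f zero
    alternate f g (suc p) = alternate g (f ∘ suc) p

    alternate-even : ∀ f g t → alternate f g (t + t) ≡ f t
    alternate-even f g zero    = refl
    alternate-even f g (suc t) =
      trans (cong (alternate g (f ∘ suc)) (ℕₚ.+-suc t t)) (alternate-even (f ∘ suc) (g ∘ suc) t)

    alternate-odd : ∀ f g t → alternate f g (suc (t + t)) ≡ g t
    alternate-odd f g = alternate-even g (f ∘ suc)

  parity : ∀ p → ∃[ t ] (p ≡ t + t ⊎ p ≡ suc (t + t))
  parity zero = 0 , inj₁ refl
  parity (suc p) with parity p
  ... | t , inj₁ p≡2t   = t , inj₂ (cong suc p≡2t)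
  ... | t , inj₂ p≡2t+1 = suc t , inj₁ (trans (cong suc p≡2t+1) (sym (ℕₚ.+-suc (suc t) t)))

  double-injective : ∀ t u → t + t ≡ u + u → t ≡ u
  double-injective t u eq =
    trans (ℕₚ.n≡⌊n+n/2⌋ t) (trans (cong ℕ.⌊_/2⌋ eq) (sym (ℕₚ.n≡⌊n+n/2⌋ u)))

  even≢odd : ∀ t u → t + t ≢ suc (u + u)
  even≢odd zero    u       ()
  even≢odd (suc t) zero    eq = ℕₚ.1+n≢0 (trans (sym (ℕₚ.+-suc t t)) (ℕₚ.suc-injective eq))
  even≢odd (suc t) (suc u) eq = even≢odd t u (ℕₚ.suc-injective
    (trans (sym (ℕₚ.+-suc t t)) (trans (ℕₚ.suc-injective eq) (cong suc (ℕₚ.+-suc u u)))))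

  double-<-cancel : ∀ {t n} → t + t < n + n → t < n
  double-<-cancel {t} {n} 2t<2n with t ℕₚ.<? n
  ... | yes t<n = t<n
  ... | no  t≮n = ⊥-elim (ℕₚ.<⇒≱ 2t<2n (ℕₚ.+-mono-≤ (ℕₚ.≮⇒≥ t≮n) (ℕₚ.≮⇒≥ t≮n)))

  alternate-steps : ∀ {A : Set} (R : ℕ → A → A → Set) n f g →
                    (∀ t → t < n → R (t + t) (f t) (g t)) →
                    (∀ t → suc t < n → R (suc (t + t)) (g t) (f (suc t))) →
                    ∀ p → suc p < n + n → R p (alternate f g p) (alternate f g (suc p))
  alternate-steps R n f g fg-step gf-step p p+1<2n with parity p
  ... | t , inj₁ refl = subst₂ (R (t + t)) (sym (alternate-even f g t)) (sym (alternate-odd f g t))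
                          (fg-step t (double-<-cancel (ℕₚ.<-trans (ℕₚ.n<1+n _) p+1<2n)))
  ... | t , inj₂ refl = subst₂ (R (suc (t + t))) (sym (alternate-odd f g t))
                          (sym (trans (cong (alternate f g) 2t+2≡) (alternate-even f g (suc t))))
                          (gf-step t (double-<-cancel (subst (_< n + n) 2t+2≡ p+1<2n)))
    where
    2t+2≡ : suc (suc (t + t)) ≡ suc t + suc t
    2t+2≡ = cong suc (sym (ℕₚ.+-suc t t))

  module Layers {X : Set} {n : ℕ} (F G : Enumeration X n) where

    private
      module F = Enumeration F
      module G = Enumeration G

    lower upper : ℕ → Bool × X
    lower t = false , F.at t
    upper t = true , G.at t

    stack : Enumeration (Bool × X) (n + n)
    stack = record
      { at       = prefixed n lower upper
      ; index    = index
      ; index<   = index<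
      ; at-index = at-index
      ; index-at = index-at
      }
      where
      index : Bool × X → ℕ
      index (false , a) = F.index a
      index (true  , x) = n + G.index x

      index< : ∀ v → index v < n + n
      index< (false , a) = ℕₚ.<-≤-trans (F.index< a) (ℕₚ.m≤m+n n n)
      index< (true  , x) = ℕₚ.+-monoʳ-< n (G.index< x)

      at-index : ∀ v → prefixed n lower upper (index v) ≡ v
      at-index (false , a) = trans (prefixed-< n lower upper (F.index< a)) (cong (false ,_) (F.at-index a))
      at-index (true  , x) = trans (prefixed-+ n lower upper (G.index x)) (cong (true ,_) (G.at-index x))

      index-at : ∀ {p} → p < n + n → index (prefixed n lower upper p) ≡ p
      index-at {p} p<2n with p ℕₚ.<? n
      ... | yes p<n = trans (cong index (prefixed-< n lower upper p<n)) (F.index-at p<n)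
      ... | no  p≮n = begin
        index (prefixed n lower upper p)       ≡⟨ cong (index ∘ prefixed n lower upper) p≡ ⟨
        index (prefixed n lower upper (n + t)) ≡⟨ cong index (prefixed-+ n lower upper t) ⟩
        n + G.index (G.at t)                   ≡⟨ cong (n +_) (G.index-at t<n) ⟩
        n + t                                  ≡⟨ p≡ ⟩
        p                                      ∎
        where
        open ≡-Reasoning
        t = p ∸ n
        p≡ : n + t ≡ p
        p≡ = ℕₚ.m+[n∸m]≡n (ℕₚ.≮⇒≥ p≮n)
        t<n : t < n
        t<n = ℕₚ.+-cancelˡ-< n t n (subst (_< n + n) (sym p≡) p<2n)

    interleave : Enumeration (Bool × X) (n + n)
    interleave = record
      { at       = alternate lower upper
      ; index    = index
      ; index<   = index<
      ; at-index = at-index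
      ; index-at = index-at
      }
      where
      index : Bool × X → ℕ
      index (false , a) = F.index a + F.index a
      index (true  , x) = suc (G.index x + G.index x)

      index< : ∀ v → index v < n + n
      index< (false , a) = ℕₚ.+-mono-< (F.index< a) (F.index< a)
      index< (true  , x) = ℕₚ.+-mono-≤-< (G.index< x) (G.index< x)

      at-index : ∀ v → alternate lower upper (index v) ≡ v
      at-index (false , a) = trans (alternate-even lower upper (F.index a)) (cong (false ,_) (F.at-index a))
      at-index (true  , x) = trans (alternate-odd lower upper (G.index x)) (cong (true ,_) (G.at-index x))

      index-at : ∀ {p} → p < n + n → index (alternate lower upper p) ≡ p
      index-at {p} p<2n with parity p
      ... | t , inj₁ refl = trans (cong index (alternate-even lower upper t))
                              (cong (λ u → u + u) (F.index-at (double-<-cancel p<2n)))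
      ... | t , inj₂ refl = trans (cong index (alternate-odd lower upper t))
                              (cong (λ u → suc (u + u)) (G.index-at (double-<-cancel 2t<2n)))
        where
        2t<2n = ℕₚ.<-trans (ℕₚ.n<1+n _) p<2n

  mirror : ℕ → ℕ → ℕ
  mirror m q with q ℕₚ.<? m
  ... | yes _ = m ∸ suc q
  ... | no  _ = q

  module _ {m : ℕ} where

    mirror-lower : ∀ {q} → q < m → mirror m q ≡ m ∸ suc q
    mirror-lower {q} q<m with q ℕₚ.<? m
    ... | yes _   = refl
    ... | no  q≮m = ⊥-elim (q≮m q<m)

    mirror-upper : ∀ {q} → m ≤ q → mirror m q ≡ q
    mirror-upper {q} m≤q with q ℕₚ.<? m
    ... | yes q<m = ⊥-elim (ℕₚ.<⇒≱ q<m m≤q)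
    ... | no  _   = refl

    private
      reflect< : ∀ {q} → q < m → m ∸ suc q < m
      reflect< {q} (s≤s _) = s≤s (ℕₚ.m∸n≤m _ q)

      reflect-involutive : ∀ {q} → q < m → m ∸ suc (m ∸ suc q) ≡ q
      reflect-involutive (s≤s q≤m-1) = ℕₚ.m∸[m∸n]≡n q≤m-1

    mirror-lower-< : ∀ {q} → q < m → mirror m q < m
    mirror-lower-< q<m = subst (_< m) (sym (mirror-lower q<m)) (reflect< q<m)

    mirror-involutive : ∀ q → mirror m (mirror m q) ≡ q
    mirror-involutive q with q ℕₚ.<? m
    ... | yes q<m = trans (mirror-lower (reflect< q<m)) (reflect-involutive q<m)
    ... | no  q≮m = mirror-upper (ℕₚ.≮⇒≥ q≮m)

    mirror-bound : ∀ {N q} → m ≤ N → q < N → mirror m q < N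
    mirror-bound {q = q} m≤N q<N with q ℕₚ.<? m
    ... | yes q<m = ℕₚ.<-≤-trans (reflect< q<m) m≤N
    ... | no  _   = q<N

    mirror-step : ∀ {q} → suc q < m → mirror m q ≡ suc (mirror m (suc q))
    mirror-step {q} q+1<m = begin
      mirror m q             ≡⟨ mirror-lower (ℕₚ.<-trans (ℕₚ.n<1+n q) q+1<m) ⟩
      m ∸ suc q              ≡⟨ ℕₚ.+-∸-assoc 1 q+1<m ⟩
      suc (m ∸ suc (suc q))  ≡⟨ cong suc (mirror-lower q+1<m) ⟨
      suc (mirror m (suc q)) ∎
      where open ≡-Reasoning

    mirror-step-< : ∀ {q} → suc q < m → suc (mirror m (suc q)) < m
    mirror-step-< {q} q+1<m =
      subst (_< m) (mirror-step q+1<m) (mirror-lower-< (ℕₚ.<-trans (ℕₚ.n<1+n q) q+1<m))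

    mirror-junction : 0 < m → mirror m (ℕ.pred m) ≡ 0 × mirror m m ≡ m
    mirror-junction (s≤s _) = trans (mirror-lower ℕₚ.≤-refl) (ℕₚ.n∸n≡0 m) , mirror-upper ℕₚ.≤-refl

  reverse-prefix : ∀ {V N} m → m ≤ N → Enumeration V N → Enumeration V N
  reverse-prefix m m≤N E = record
    { at       = at ∘ mirror m
    ; index    = mirror m ∘ index
    ; index<   = λ v → mirror-bound m≤N (index< v)
    ; at-index = λ v → trans (cong at (mirror-involutive {m} (index v))) (at-index v)
    ; index-at = λ {p} p<N →
        trans (cong (mirror m) (index-at (mirror-bound m≤N p<N))) (mirror-involutive {m} p)
    }
    where open Enumeration E

  reversed-steps : ∀ {A : Set} (R : A → A → Set) → (∀ x y → R x y → R y x) →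
                   ∀ {N m} → 0 < m → m ≤ N → (f : ℕ → A) →
                   (∀ p → suc p < N → suc p ≢ m → R (f p) (f (suc p))) → R (f 0) (f m) →
                   ∀ p → suc p < N → R (f (mirror m p)) (f (mirror m (suc p)))
  reversed-steps R R-sym {N} {m} 0<m m≤N f step junction p p+1<N with ℕₚ.<-cmp (suc p) m
  ... | tri< p+1<m _ _ = subst (λ q → R (f q) (f r)) (sym (mirror-step p+1<m))
                           (R-sym _ _ (step r (ℕₚ.<-≤-trans r+1<m m≤N) (ℕₚ.<⇒≢ r+1<m)))
    where
    r = mirror m (suc p)
    r+1<m = mirror-step-< p+1<m
  ... | tri≈ _ refl _ = subst₂ (λ q q′ → R (f q) (f q′))
                          (sym (proj₁ (mirror-junction 0<m))) (sym (proj₂ (mirror-junction 0<m))) junction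
  ... | tri> _ _ m<p+1 = subst₂ (λ q q′ → R (f q) (f q′))
                           (sym (mirror-upper (ℕₚ.≤-pred m<p+1))) (sym (mirror-upper (ℕₚ.<⇒≤ m<p+1)))
                           (step p p+1<N (ℕₚ.>⇒≢ m<p+1))

  module ReversedCycle {V : Set} {Adj : V → V → Set} {M : ℕ} (E : Enumeration V (suc M))
    (m : ℕ) (m≤M : m ≤ M)
    (step : ∀ p → suc p < suc M → Adj (Enumeration.at E (mirror m p)) (Enumeration.at E (mirror m (suc p))))
    (wrap : Adj (Enumeration.at E (mirror m M)) (Enumeration.at E (mirror m 0))) where

    open EnumeratedCycle {Adj = Adj} (reverse-prefix m (ℕₚ.m≤n⇒m≤1+n m≤M) E) step wrap public
    open Enumeration E

    unreversed-edge : ∀ {p} → suc p < suc M → suc p ≢ m → EdgeOf cycle (at p) (at (suc p))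
    unreversed-edge {p} p+1<N p+1≢m with ℕₚ.<-cmp (suc p) m
    ... | tri< p+1<m _ _ = EdgeOf-sym {C = cycle}
      (subst₂ (λ x y → EdgeOf cycle (at x) (at y)) (mirror-involutive {m} (suc p)) mirror-q+1≡p
        (step-edge (ℕₚ.<-≤-trans (mirror-step-< p+1<m) (ℕₚ.m≤n⇒m≤1+n m≤M))))
      where
      q = mirror m (suc p)
      mirror-q+1≡p : mirror m (suc q) ≡ p
      mirror-q+1≡p = ℕₚ.suc-injective
        (trans (sym (mirror-step (mirror-step-< p+1<m))) (mirror-involutive {m} (suc p)))
    ... | tri≈ _ p+1≡m _ = ⊥-elim (p+1≢m p+1≡m)
    ... | tri> _ _ m<p+1 = subst₂ (λ x y → EdgeOf cycle (at x) (at y))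
                             (mirror-upper (ℕₚ.≤-pred m<p+1)) (mirror-upper (ℕₚ.<⇒≤ m<p+1))
                             (step-edge p+1<N)

    junction-edge : 0 < m → EdgeOf cycle (at 0) (at m)
    junction-edge 0<m@(s≤s _) = subst₂ (λ x y → EdgeOf cycle (at x) (at y))
                                  (proj₁ (mirror-junction 0<m)) (proj₂ (mirror-junction 0<m))
                                  (step-edge (s≤s m≤M))

open Enumerations

module ModularArithmetic where

  open import Data.Integer using (ℤ; +_; -[1+_]; 0ℤ; 1ℤ; _+_; _-_; _*_; -_)
  import Data.Integer.Properties as ℤₚ
  open import Data.Integer.DivMod using (_%ℕ_; _/ℕ_; n%ℕd<d; a≡a%ℕn+[a/ℕn]*n)
  open import Data.Integer.Tactic.RingSolver using (solve; solve-∀)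
  open import Data.List using (_∷_; [])
  open import Data.Nat.DivMod using (_mod_; _%_; _/_; m≡m%n+[m/n]*n)
  open import Data.Nat.GCD using (module Bézout)
  open import Data.Nat.Coprimality using (gcd≡1⇒coprime; coprime-Bézout)
  open import Relation.Binary.Bundles using (Setoid)
  import Relation.Binary.Reasoning.Setoid as SetoidReasoning

  module Congruence (m : ℤ) where

    infix 4 _≈_
    record _≈_ (x y : ℤ) : Set where
      constructor congruent
      field
        quotient : ℤ
        equation : x ≡ y + quotient * m

    ≈-reflexive : ∀ {x y} → x ≡ y → x ≈ y
    ≈-reflexive {x} refl = congruent 0ℤ (solve (x ∷ m ∷ []))

    ≈-refl : ∀ {x} → x ≈ x
    ≈-refl = ≈-reflexive refl

    ≈-sym : ∀ {x y} → x ≈ y → y ≈ x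
    ≈-sym {y = y} (congruent q refl) = congruent (- q) (solve (y ∷ q ∷ m ∷ []))

    ≈-trans : ∀ {x y z} → x ≈ y → y ≈ z → x ≈ z
    ≈-trans {z = z} (congruent q refl) (congruent r refl) =
      congruent (q + r) (solve (z ∷ q ∷ r ∷ m ∷ []))

    ≈-setoid : Setoid _ _
    ≈-setoid = record
      { Carrier       = ℤ
      ; _≈_           = _≈_
      ; isEquivalence = record { refl = ≈-refl ; sym = ≈-sym ; trans = ≈-trans }
      }

    +-cong : ∀ {x y u v} → x ≈ y → u ≈ v → x + u ≈ y + v
    +-cong {y = y} {v = v} (congruent q refl) (congruent r refl) =
      congruent (q + r) (solve (y ∷ v ∷ q ∷ r ∷ m ∷ []))

    *-cong : ∀ {x y u v} → x ≈ y → u ≈ v → x * u ≈ y * v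
    *-cong {y = y} {v = v} (congruent q refl) (congruent r refl) =
      congruent (q * v + y * r + q * r * m) (solve (y ∷ v ∷ q ∷ r ∷ m ∷ []))

    +-congˡ : ∀ x {u v} → u ≈ v → x + u ≈ x + v
    +-congˡ x = +-cong (≈-refl {x})

    +-congʳ : ∀ {x y} u → x ≈ y → x + u ≈ y + u
    +-congʳ u x≈y = +-cong x≈y (≈-refl {u})

    *-congˡ : ∀ x {u v} → u ≈ v → x * u ≈ x * v
    *-congˡ x = *-cong (≈-refl {x})

    *-congʳ : ∀ {x y} u → x ≈ y → x * u ≈ y * u
    *-congʳ u x≈y = *-cong x≈y (≈-refl {u})

    -‿cong : ∀ {x y} → x ≈ y → - x ≈ - y
    -‿cong {y = y} (congruent q refl) = congruent (- q) (solve (y ∷ q ∷ m ∷ []))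

    +-cancelˡ : ∀ x {y z} → x + y ≈ x + z → y ≈ z
    +-cancelˡ x {y} {z} x+y≈x+z =
      ≈-trans (≈-reflexive (cancel x y)) (≈-trans (+-congˡ (- x) x+y≈x+z) (≈-reflexive (sym (cancel x z))))
      where
      cancel : ∀ x y → y ≡ - x + (x + y)
      cancel x y = solve (x ∷ y ∷ [])

    +-cancelʳ : ∀ {x y} z → x + z ≈ y + z → x ≈ y
    +-cancelʳ {x} {y} z x+z≈y+z =
      +-cancelˡ z (≈-trans (≈-reflexive (ℤₚ.+-comm z x)) (≈-trans x+z≈y+z (≈-reflexive (ℤₚ.+-comm y z))))

    m≈0 : m ≈ 0ℤ
    m≈0 = congruent 1ℤ (solve (m ∷ []))

  module Modulo (n : ℕ) .{{_ : NonZero n}} where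

    open Congruence (+ n) public renaming (m≈0 to n≈0)

    %ℕ-≈ : ∀ z → + (z %ℕ n) ≈ z
    %ℕ-≈ z = ≈-sym (congruent (z /ℕ n) (a≡a%ℕn+[a/ℕn]*n z n))

    private
      drop-multiple : ∀ y q m → (y + q * m) + (- q) * m ≡ y
      drop-multiple = solve-∀

      multiple-of-n-≤ : ∀ {x y} q → + x ≡ + y + + suc q * + n → n ℕ.≤ x
      multiple-of-n-≤ {x} {y} q eq =
        subst (n ℕ.≤_) (sym x≡) (ℕₚ.≤-trans (ℕₚ.m≤n*m n (suc q)) (ℕₚ.m≤n+m _ y))
        where
        x≡ : x ≡ y ℕ.+ suc q ℕ.* n
        x≡ = ℤₚ.+-injective (trans eq (cong (_+_ (+ y)) (sym (ℤₚ.pos-* (suc q) n))))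

    -- a difference of two residues lies strictly between -n and n, so only the zero multiple of n fits
    residue-injective : ∀ {x y} → x ℕ.< n → y ℕ.< n → + x ≈ + y → x ≡ y
    residue-injective {x} {y} _ _ (congruent (+ zero) eq) =
      ℤₚ.+-injective (trans eq (ℤₚ.+-identityʳ (+ y)))
    residue-injective x<n _ (congruent (+ suc q) eq) =
      ⊥-elim (ℕₚ.<⇒≱ x<n (multiple-of-n-≤ q eq))
    residue-injective {x} {y} _ y<n (congruent -[1+ q ] eq) =
      ⊥-elim (ℕₚ.<⇒≱ y<n (multiple-of-n-≤ q
        (sym (trans (cong (_+ + suc q * + n) eq) (drop-multiple (+ y) -[1+ q ] (+ n))))))

    ≈-dec : ∀ x y → Dec (x ≈ y)
    ≈-dec x y with x %ℕ n ℕₚ.≟ y %ℕ n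
    ... | yes eq = yes (≈-trans (≈-sym (%ℕ-≈ x)) (≈-trans (≈-reflexive (cong +_ eq)) (%ℕ-≈ y)))
    ... | no neq = no λ x≈y → neq (residue-injective (n%ℕd<d x n) (n%ℕd<d y n)
                     (≈-trans (%ℕ-≈ x) (≈-trans x≈y (≈-sym (%ℕ-≈ y)))))

    ⟦_⟧ : Fin n → ℤ
    ⟦ a ⟧ = + toℕ a

    [_] : ℤ → Fin n
    [ z ] = fromℕ< (n%ℕd<d z n)

    ⟦[]⟧ : ∀ z → ⟦ [ z ] ⟧ ≈ z
    ⟦[]⟧ z = subst (_≈ z) (cong +_ (sym (Finₚ.toℕ-fromℕ< _))) (%ℕ-≈ z)

    ⟦⟧-injective : ∀ {a b} → ⟦ a ⟧ ≈ ⟦ b ⟧ → a ≡ b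
    ⟦⟧-injective {a} {b} eq = Finₚ.toℕ-injective (residue-injective (Finₚ.toℕ<n a) (Finₚ.toℕ<n b) eq)

    []-cong : ∀ {z w} → z ≈ w → [ z ] ≡ [ w ]
    []-cong {z} {w} z≈w = ⟦⟧-injective (≈-trans (⟦[]⟧ z) (≈-trans z≈w (≈-sym (⟦[]⟧ w))))

    []-injective : ∀ {z w} → [ z ] ≡ [ w ] → z ≈ w
    []-injective {z} {w} eq =
      ≈-trans (≈-sym (⟦[]⟧ z)) (≈-trans (≈-reflexive (cong ⟦_⟧ eq)) (⟦[]⟧ w))

    []-⟦⟧ : ∀ a → [ ⟦ a ⟧ ] ≡ a
    []-⟦⟧ a = ⟦⟧-injective (⟦[]⟧ ⟦ a ⟧)

    ⟦mod⟧ : ∀ m → ⟦ m mod n ⟧ ≈ + m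
    ⟦mod⟧ m = subst (_≈ + m) (cong +_ (sym (Finₚ.toℕ-fromℕ< _)))
      (≈-sym (congruent (+ (m / n)) (begin
        + m                         ≡⟨ cong +_ (m≡m%n+[m/n]*n m n) ⟩
        + (m % n ℕ.+ m / n ℕ.* n)   ≡⟨ ℤₚ.pos-+ (m % n) (m / n ℕ.* n) ⟩
        + (m % n) + + (m / n ℕ.* n) ≡⟨ cong (_+_ (+ (m % n))) (ℤₚ.pos-* (m / n) n) ⟩
        + (m % n) + + (m / n) * + n ∎)))
      where open ≡-Reasoning

    ⟦negℤn⟧ : ∀ a → ⟦ negℤn a ⟧ ≈ - ⟦ a ⟧
    ⟦negℤn⟧ a = begin
      ⟦ negℤn a ⟧       ≈⟨ ⟦mod⟧ (n ℕ.∸ toℕ a) ⟩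
      + (n ℕ.∸ toℕ a)   ≡⟨ trans (ℤₚ.m-n≡m⊖n n (toℕ a)) (ℤₚ.⊖-≥ a≤n) ⟨
      + n - ⟦ a ⟧       ≈⟨ +-congʳ (- ⟦ a ⟧) n≈0 ⟩
      0ℤ - ⟦ a ⟧        ≡⟨ ℤₚ.+-identityˡ (- ⟦ a ⟧) ⟩
      - ⟦ a ⟧           ∎
      where
      open SetoidReasoning ≈-setoid
      a≤n = ℕₚ.<⇒≤ (Finₚ.toℕ<n a)

    ⟦addℤn⟧ : ∀ a b → ⟦ addℤn a b ⟧ ≈ ⟦ a ⟧ + ⟦ b ⟧
    ⟦addℤn⟧ a b = ≈-trans (⟦mod⟧ (toℕ a ℕ.+ toℕ b)) (≈-reflexive (ℤₚ.pos-+ (toℕ a) (toℕ b)))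

    unit : ∀ {m} → gcd m n ≡ 1 → Σ ℤ λ m⁻¹ → m⁻¹ * + m ≈ 1ℤ
    unit {m} gcd≡1 with coprime-Bézout (gcd≡1⇒coprime gcd≡1)
    ... | Bézout.+- x y eq = + x , congruent (+ y) (begin
        + x * + m         ≡⟨ ℤₚ.pos-* x m ⟨
        + (x ℕ.* m)       ≡⟨ cong +_ eq ⟨
        + (1 ℕ.+ y ℕ.* n) ≡⟨ cong (_+_ 1ℤ) (ℤₚ.pos-* y n) ⟩
        1ℤ + + y * + n    ∎)
      where open ≡-Reasoning
    ... | Bézout.-+ x y eq = - + x , congruent (- + y) (negated (+ x) (+ m) (+ y) (+ n) (begin
        1ℤ + + x * + m    ≡⟨ cong (_+_ 1ℤ) (ℤₚ.pos-* x m) ⟨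
        + (1 ℕ.+ x ℕ.* m) ≡⟨ cong +_ eq ⟩
        + (y ℕ.* n)       ≡⟨ ℤₚ.pos-* y n ⟩
        + y * + n         ∎))
      where
      open ≡-Reasoning
      negated : ∀ a b c d → 1ℤ + a * b ≡ c * d → - a * b ≡ 1ℤ + - c * d
      negated a b c d eq = begin
        - a * b           ≡⟨ solve (a ∷ b ∷ []) ⟩
        1ℤ - (1ℤ + a * b) ≡⟨ cong (_-_ 1ℤ) eq ⟩
        1ℤ - c * d        ≡⟨ solve (c ∷ d ∷ []) ⟩
        1ℤ + - c * d      ∎

    module Progression (c m m⁻¹ : ℤ) (m⁻¹m≈1 : m⁻¹ * m ≈ 1ℤ) where

      open SetoidReasoning ≈-setoid

      term : ℕ → ℤ
      term t = c + + t * m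

      term-suc : ∀ t → term (suc t) ≡ term t + m
      term-suc t = trans (cong (λ x → c + x * m) (ℤₚ.pos-+ 1 t)) (shift (+ t))
        where
        shift : ∀ x → c + (1ℤ + x) * m ≡ c + x * m + m
        shift x = solve (x ∷ c ∷ m ∷ [])

      term-last : ∀ {t} → suc t ≡ n → term t ≈ c - m
      term-last {t} refl = begin
        c + + t * m              ≡⟨ unshift (+ t) ⟩
        c - m + (1ℤ + + t) * m   ≡⟨ cong (λ x → c - m + x * m) (ℤₚ.pos-+ 1 t) ⟨
        c - m + + n * m          ≈⟨ +-congˡ (c - m) (*-congʳ m n≈0) ⟩
        c - m + 0ℤ * m           ≡⟨ solve (c ∷ m ∷ []) ⟩
        c - m                    ∎
        where
        unshift : ∀ x → c + x * m ≡ c - m + (1ℤ + x) * m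
        unshift x = solve (x ∷ c ∷ m ∷ [])

      private
        solve-for : ∀ {z} x → z ≈ c + x * m → (z - c) * m⁻¹ ≈ x
        solve-for {z} x z≈ = begin
          (z - c) * m⁻¹            ≈⟨ *-congʳ m⁻¹ (+-congʳ (- c) z≈) ⟩
          (c + x * m - c) * m⁻¹    ≡⟨ solve (x ∷ c ∷ m ∷ m⁻¹ ∷ []) ⟩
          x * (m⁻¹ * m)            ≈⟨ *-congˡ x m⁻¹m≈1 ⟩
          x * 1ℤ                   ≡⟨ ℤₚ.*-identityʳ x ⟩
          x                        ∎

        recover : ∀ z → c + (z - c) * m⁻¹ * m ≈ z
        recover z = begin
          c + (z - c) * m⁻¹ * m          ≡⟨ solve (z ∷ c ∷ m ∷ m⁻¹ ∷ []) ⟩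
          z + (z - c) * (m⁻¹ * m - 1ℤ)   ≈⟨ +-congˡ z (*-congˡ (z - c) (+-congʳ (- 1ℤ) m⁻¹m≈1)) ⟩
          z + (z - c) * (1ℤ - 1ℤ)        ≡⟨ solve (z ∷ c ∷ []) ⟩
          z                              ∎

      term-injective : ∀ {t u} → t ℕ.< n → u ℕ.< n → term t ≈ term u → t ≡ u
      term-injective {t} {u} t<n u<n t≈u = residue-injective t<n u<n
        (≈-trans (≈-sym (solve-for (+ t) (≈-refl {term t}))) (solve-for (+ u) t≈u))

      -- needs 2 < n: for n = 2 both steps of the cycle join term 0 and term 1
      only-wrap-joins : ∀ {l t} → suc l ≡ n → 2 ℕ.< n → suc t ℕ.< n →
                        ¬ ((term t ≈ term l × term (suc t) ≈ term 0) ⊎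
                           (term t ≈ term 0 × term (suc t) ≈ term l))
      only-wrap-joins refl 2<n t+1<n (inj₁ (t≈l , _))
        with term-injective (ℕₚ.<-trans (ℕₚ.n<1+n _) t+1<n) ℕₚ.≤-refl t≈l
      ... | refl = ℕₚ.<-irrefl refl t+1<n
      only-wrap-joins refl 2<n t+1<n (inj₂ (t≈0 , t+1≈l))
        with term-injective (ℕₚ.<-trans (ℕₚ.n<1+n _) t+1<n) (ℕₚ.<-trans ℕₚ.0<1+n t+1<n) t≈0
      ... | refl with term-injective t+1<n ℕₚ.≤-refl t+1≈l
      ...   | refl = ℕₚ.<-irrefl refl 2<n

      index : Fin n → ℕ
      index a = (⟦ a ⟧ - c) * m⁻¹ %ℕ n

      index< : ∀ a → index a ℕ.< n
      index< a = n%ℕd<d ((⟦ a ⟧ - c) * m⁻¹) n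

      private
        index≈ : ∀ a → + index a ≈ (⟦ a ⟧ - c) * m⁻¹
        index≈ a = %ℕ-≈ ((⟦ a ⟧ - c) * m⁻¹)

      term-index : ∀ a → term (index a) ≈ ⟦ a ⟧
      term-index a = ≈-trans (+-congˡ c (*-congʳ m (index≈ a))) (recover ⟦ a ⟧)

      term-surjective : ∀ z → Σ ℕ λ t → t ℕ.< n × term t ≈ z
      term-surjective z = index [ z ] , index< [ z ] , ≈-trans (term-index [ z ]) (⟦[]⟧ z)

      enumeration : Enumeration (Fin n) n
      enumeration = record
        { at       = λ t → [ term t ]
        ; index    = index
        ; index<   = index<
        ; at-index = λ a → ⟦⟧-injective (≈-trans (⟦[]⟧ (term (index a))) (term-index a))
        ; index-at = λ {t} t<n → residue-injective (index< [ term t ]) t<n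
                       (≈-trans (index≈ [ term t ]) (solve-for (+ t) (⟦[]⟧ (term t))))
        }

module DihedralCayleyGraph (n : ℕ) .{{_ : NonZero n}} (i j k : ℕ) where

  open import Data.Integer using (ℤ; +_; _+_; _-_; -_)
  import Data.Integer.Properties as ℤₚ
  open import Data.Integer.Tactic.RingSolver using (solve)
  open import Data.List using (_∷_; [])
  open import Data.Nat.DivMod using (_mod_)
  import Relation.Binary.Reasoning.Setoid as SetoidReasoning
  open ModularArithmetic
  open Modulo n

  I J K : ℤ
  I = + i
  J = + j
  K = + k

  Connection : Bool → ℤ → Set
  Connection false δ = δ ≈ I ⊎ δ ≈ - I
  Connection true  δ = δ ≈ J ⊎ δ ≈ K

  offset : D n → D n → ℤ
  offset (false , a) (_ , x) = ⟦ x ⟧ - ⟦ a ⟧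
  offset (true  , a) (_ , x) = ⟦ a ⟧ - ⟦ x ⟧

  record Edge (g h : D n) : Set where
    constructor edge
    field
      connection : Connection (proj₁ g xor proj₁ h) (offset g h)

  private
    ≈⇒[]≡ : ∀ {z a} → z ≈ ⟦ a ⟧ → [ z ] ≡ a
    ≈⇒[]≡ {a = a} z≈a = trans ([]-cong z≈a) ([]-⟦⟧ a)

    []≡⇒≈ : ∀ {z a} → [ z ] ≡ a → z ≈ ⟦ a ⟧
    []≡⇒≈ {z} refl = ≈-sym (⟦[]⟧ z)

    ⟦x-a⟧ : ∀ x a → ⟦ addℤn x (negℤn a) ⟧ ≈ ⟦ x ⟧ - ⟦ a ⟧
    ⟦x-a⟧ x a = ≈-trans (⟦addℤn⟧ x (negℤn a)) (+-congˡ ⟦ x ⟧ (⟦negℤn⟧ a))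

    ⟦-x+a⟧ : ∀ x a → ⟦ addℤn (negℤn x) a ⟧ ≈ ⟦ a ⟧ - ⟦ x ⟧
    ⟦-x+a⟧ x a = ≈-trans (⟦addℤn⟧ (negℤn x) a)
      (≈-trans (+-congʳ ⟦ a ⟧ (⟦negℤn⟧ x)) (≈-reflexive (ℤₚ.+-comm (- ⟦ x ⟧) ⟦ a ⟧)))

  quotient-coordinates : ∀ g h → h · (g ⁻¹) ≡ (proj₁ g xor proj₁ h , [ offset g h ])
  quotient-coordinates (false , a) (false , x) = cong (false ,_) (sym (≈⇒[]≡ (≈-sym (⟦x-a⟧ x a))))
  quotient-coordinates (false , a) (true  , x) = cong (true  ,_) (sym (≈⇒[]≡ (≈-sym (⟦x-a⟧ x a))))
  quotient-coordinates (true  , a) (false , x) = cong (true  ,_) (sym (≈⇒[]≡ (≈-sym (⟦-x+a⟧ x a))))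
  quotient-coordinates (true  , a) (true  , x) = cong (false ,_) (sym (≈⇒[]≡ (≈-sym (⟦-x+a⟧ x a))))

  private
    ⟦α^-i⟧ : ⟦ negℤn (i mod n) ⟧ ≈ - I
    ⟦α^-i⟧ = ≈-trans (⟦negℤn⟧ (i mod n)) (-‿cong (⟦mod⟧ i))

  connection⇒S : ∀ b δ → Connection b δ → S {n} i j k (b , [ δ ])
  connection⇒S false δ (inj₁ δ≈I)  =
    inj₁ (cong (false ,_) (≈⇒[]≡ (≈-trans δ≈I (≈-sym (⟦mod⟧ i)))))
  connection⇒S false δ (inj₂ δ≈-I) =
    inj₂ (inj₁ (cong (false ,_) (≈⇒[]≡ (≈-trans δ≈-I (≈-sym ⟦α^-i⟧)))))
  connection⇒S true  δ (inj₁ δ≈J)  =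
    inj₂ (inj₂ (inj₁ (cong (true ,_) (≈⇒[]≡ (≈-trans δ≈J (≈-sym (⟦mod⟧ j)))))))
  connection⇒S true  δ (inj₂ δ≈K)  =
    inj₂ (inj₂ (inj₂ (cong (true ,_) (≈⇒[]≡ (≈-trans δ≈K (≈-sym (⟦mod⟧ k)))))))

  S⇒connection : ∀ b δ → S {n} i j k (b , [ δ ]) → Connection b δ
  S⇒connection false δ (inj₁ eq)               = inj₁ (≈-trans ([]≡⇒≈ (cong proj₂ eq)) (⟦mod⟧ i))
  S⇒connection false δ (inj₂ (inj₁ eq))        = inj₂ (≈-trans ([]≡⇒≈ (cong proj₂ eq)) ⟦α^-i⟧)
  S⇒connection true  δ (inj₂ (inj₂ (inj₁ eq))) = inj₁ (≈-trans ([]≡⇒≈ (cong proj₂ eq)) (⟦mod⟧ j))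
  S⇒connection true  δ (inj₂ (inj₂ (inj₂ eq))) = inj₂ (≈-trans ([]≡⇒≈ (cong proj₂ eq)) (⟦mod⟧ k))
  S⇒connection false δ (inj₂ (inj₂ (inj₁ ())))
  S⇒connection false δ (inj₂ (inj₂ (inj₂ ())))
  S⇒connection true  δ (inj₁ ())
  S⇒connection true  δ (inj₂ (inj₁ ()))

  Adj : D n → D n → Set
  Adj = CayAdj {n} i j k

  edge⇒adj : ∀ {g h} → Edge g h → Adj g h
  edge⇒adj {g} {h} (edge c) = subst (S i j k) (sym (quotient-coordinates g h)) (connection⇒S _ _ c)

  adj⇒edge : ∀ g h → Adj g h → Edge g h
  adj⇒edge g h adj = edge (S⇒connection _ _ (subst (S i j k) (quotient-coordinates g h) adj))

  private
    flip-offset : ∀ x y {c} → x - y ≈ c → y - x ≈ - c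
    flip-offset x y δ≈c = ≈-trans (≈-reflexive (negation x y)) (-‿cong δ≈c)
      where
      negation : ∀ x y → y - x ≡ - (x - y)
      negation x y = solve (x ∷ y ∷ [])

    flip-offset-I : ∀ x y → x - y ≈ - I → y - x ≈ I
    flip-offset-I x y δ≈-I = ≈-trans (flip-offset x y δ≈-I) (≈-reflexive (ℤₚ.neg-involutive I))

    reverse-α : ∀ x y → Connection false (x - y) → Connection false (y - x)
    reverse-α x y (inj₁ δ≈I)  = inj₂ (flip-offset x y δ≈I)
    reverse-α x y (inj₂ δ≈-I) = inj₁ (flip-offset-I x y δ≈-I)

  Edge-sym : ∀ {g h} → Edge g h → Edge h g
  Edge-sym {false , a} {false , x} (edge c) = edge (reverse-α ⟦ x ⟧ ⟦ a ⟧ c)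
  Edge-sym {false , a} {true  , x} (edge c) = edge c
  Edge-sym {true  , a} {false , x} (edge c) = edge c
  Edge-sym {true  , a} {true  , x} (edge c) = edge (reverse-α ⟦ a ⟧ ⟦ x ⟧ c)

  F T : ℤ → D n
  F z = false , [ z ]
  T z = true  , [ z ]

  F-cong : ∀ {z w} → z ≈ w → F z ≡ F w
  F-cong = cong (false ,_) ∘ []-cong

  T-cong : ∀ {z w} → z ≈ w → T z ≡ T w
  T-cong = cong (true ,_) ∘ []-cong

  F-injective : ∀ z w → F z ≡ F w → z ≈ w
  F-injective _ _ = []-injective ∘ cong proj₂

  T-injective : ∀ z w → T z ≡ T w → z ≈ w
  T-injective _ _ = []-injective ∘ cong proj₂

  vertex-⟦⟧ : ∀ b a → _≡_ {A = D n} (b , [ ⟦ a ⟧ ]) (b , a)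
  vertex-⟦⟧ b a = cong (b ,_) ([]-⟦⟧ a)

  private
    difference : ∀ z {w c} → w ≈ z + c → ⟦ [ w ] ⟧ - ⟦ [ z ] ⟧ ≈ c
    difference z {w} {c} w≈z+c = begin
      ⟦ [ w ] ⟧ - ⟦ [ z ] ⟧  ≈⟨ +-cong (⟦[]⟧ w) (-‿cong (⟦[]⟧ z)) ⟩
      w - z                  ≈⟨ +-congʳ (- z) w≈z+c ⟩
      z + c - z              ≡⟨ solve (z ∷ c ∷ []) ⟩
      c                      ∎
      where open SetoidReasoning ≈-setoid

    undifference : ∀ z w {c} → ⟦ [ w ] ⟧ - ⟦ [ z ] ⟧ ≈ c → w ≈ z + c
    undifference z w {c} δ≈c = begin
      w                                        ≈⟨ ⟦[]⟧ w ⟨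
      ⟦ [ w ] ⟧                                ≡⟨ split ⟦ [ w ] ⟧ ⟦ [ z ] ⟧ ⟩
      ⟦ [ z ] ⟧ + (⟦ [ w ] ⟧ - ⟦ [ z ] ⟧)      ≈⟨ +-cong (⟦[]⟧ z) δ≈c ⟩
      z + c                                    ∎
      where
      open SetoidReasoning ≈-setoid
      split : ∀ x y → x ≡ y + (x - y)
      split x y = solve (x ∷ y ∷ [])

  α-edge : ∀ z {w} → w ≈ z + I → Edge (F z) (F w)
  α-edge z w≈ = edge (inj₁ (difference z w≈))

  α-edgeᵀ : ∀ {z} w → z ≈ w + I → Edge (T z) (T w)
  α-edgeᵀ w z≈ = edge (inj₁ (difference w z≈))

  J-edge : ∀ z {w} → w ≈ z + J → Edge (F z) (T w)
  J-edge z w≈ = edge (inj₁ (difference z w≈))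

  K-edge : ∀ z {w} → w ≈ z + K → Edge (F z) (T w)
  K-edge z w≈ = edge (inj₂ (difference z w≈))

  α-edge-cases : ∀ z w → Edge (F z) (F w) → w ≈ z + I ⊎ z ≈ w + I
  α-edge-cases z w (edge (inj₁ δ≈I))  = inj₁ (undifference z w δ≈I)
  α-edge-cases z w (edge (inj₂ δ≈-I)) =
    inj₂ (undifference w z (flip-offset-I ⟦ [ w ] ⟧ ⟦ [ z ] ⟧ δ≈-I))

  α-edgeᵀ-cases : ∀ z w → Edge (T z) (T w) → z ≈ w + I ⊎ w ≈ z + I
  α-edgeᵀ-cases z w (edge (inj₁ δ≈I))  = inj₁ (undifference w z δ≈I)
  α-edgeᵀ-cases z w (edge (inj₂ δ≈-I)) =
    inj₂ (undifference z w (flip-offset-I ⟦ [ z ] ⟧ ⟦ [ w ] ⟧ δ≈-I))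

  β-edge-cases : ∀ z w → Edge (F z) (T w) → w ≈ z + J ⊎ w ≈ z + K
  β-edge-cases z w (edge (inj₁ δ≈J)) = inj₁ (undifference z w δ≈J)
  β-edge-cases z w (edge (inj₂ δ≈K)) = inj₂ (undifference z w δ≈K)

module Decomposition (n₁ i j k : ℕ) (3≤n : 3 ℕ.≤ suc n₁) (0<i : 0 ℕ.< i) (i<n : i ℕ.< suc n₁)
  (j<k : j ℕ.< k) (k<n : k ℕ.< suc n₁)
  (gcd[i,n]≡1 : gcd i (suc n₁) ≡ 1) (gcd[k-j,n]≡1 : gcd (k ℕ.∸ j) (suc n₁) ≡ 1) where

  open import Data.Integer using (ℤ; +_; 0ℤ; 1ℤ; _+_; _-_; _*_; -_)
  import Data.Integer.Properties as ℤₚ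
  open import Data.Integer.Tactic.RingSolver using (solve)
  open import Data.List using (_∷_; [])
  open import Data.Nat using (_≤_; _<_; _∸_)
  import Relation.Binary.Reasoning.Setoid as SetoidReasoning
  open ModularArithmetic

  n : ℕ
  n = suc n₁

  open Modulo n
  open DihedralCayleyGraph n i j k
  open SetoidReasoning ≈-setoid

  Δ : ℤ
  Δ = + (k ∸ j)

  K≡J+Δ : K ≡ J + Δ
  K≡J+Δ = trans (cong +_ (sym (ℕₚ.m+[n∸m]≡n (ℕₚ.<⇒≤ j<k)))) (ℤₚ.pos-+ j (k ∸ j))

  Δ-unit : Σ ℤ λ Δ⁻¹ → Δ⁻¹ * Δ ≈ 1ℤ
  Δ-unit = unit {k ∸ j} gcd[k-j,n]≡1

  I-unit : Σ ℤ λ I⁻¹ → I⁻¹ * I ≈ 1ℤ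
  I-unit = unit {i} gcd[i,n]≡1

  -I-unit : - proj₁ I-unit * - I ≈ 1ℤ
  -I-unit = ≈-trans (≈-reflexive (neg*neg (proj₁ I-unit) I)) (proj₂ I-unit)
    where
    neg*neg : ∀ x y → - x * - y ≡ x * y
    neg*neg x y = solve (x ∷ y ∷ [])

  module HF = Progression 0ℤ Δ (proj₁ Δ-unit) (proj₂ Δ-unit)
  module HT = Progression K Δ (proj₁ Δ-unit) (proj₂ Δ-unit)
  module BF = Progression I I (proj₁ I-unit) (proj₂ I-unit)
  module BT = Progression J (- I) (- proj₁ I-unit) -I-unit

  2n≡n+n : 2 ℕ.* n ≡ n ℕ.+ n
  2n≡n+n = cong (n ℕ.+_) (ℕₚ.+-identityʳ n)

  H B : Enumeration (D n) (2 ℕ.* n)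
  H = resize (sym 2n≡n+n) (Layers.interleave HF.enumeration HT.enumeration)
  B = resize (sym 2n≡n+n) (Layers.stack BF.enumeration BT.enumeration)

  module H = Enumeration H
  module B = Enumeration B

  hF hT bF bT : ℕ → D n
  hF t = F (HF.term t)
  hT t = T (HT.term t)
  bF t = F (BF.term t)
  bT t = T (BT.term t)

  H-even : ∀ t → H.at (t ℕ.+ t) ≡ hF t
  H-even = alternate-even hF hT

  H-odd : ∀ t → H.at (suc (t ℕ.+ t)) ≡ hT t
  H-odd = alternate-odd hF hT

  B-lower : ∀ {t} → t < n → B.at t ≡ bF t
  B-lower = prefixed-< n bF bT

  B-upper : ∀ t → B.at (n ℕ.+ t) ≡ bT t
  B-upper = prefixed-+ n bF bT

  -- 2 * n reduces to suc M, so positions on the cycles range over 0 … M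
  M : ℕ
  M = n₁ ℕ.+ suc (n₁ ℕ.+ 0)

  M≡n+n₁ : M ≡ n ℕ.+ n₁
  M≡n+n₁ = trans (cong (n₁ ℕ.+_) (cong suc (ℕₚ.+-identityʳ n₁))) (ℕₚ.+-comm n₁ n)

  lower-half : ∀ {t} → t < n → t < 2 ℕ.* n
  lower-half t<n = ℕₚ.<-≤-trans t<n (ℕₚ.m≤m+n n (n ℕ.+ 0))

  upper-half : ∀ {t} → t < n → n ℕ.+ t < 2 ℕ.* n
  upper-half {t} t<n = subst (n ℕ.+ t <_) (sym 2n≡n+n) (ℕₚ.+-monoʳ-< n t<n)

  odd-position : ∀ {t} → t < n → suc (t ℕ.+ t) < 2 ℕ.* n
  odd-position {t} t<n = subst (suc (t ℕ.+ t) <_) (sym 2n≡n+n) (ℕₚ.+-mono-≤-< t<n t<n)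

  below-last : ∀ {t} → t < n → t ≢ n₁ → suc t < n
  below-last (s≤s t≤n₁) t≢n₁ = s≤s (ℕₚ.≤∧≢⇒< t≤n₁ t≢n₁)

  I≉0 : ¬ I ≈ 0ℤ
  I≉0 I≈0 = ℕₚ.<⇒≢ 0<i (sym (residue-injective i<n (s≤s z≤n) I≈0))

  K≉J : ¬ K ≈ J
  K≉J K≈J = ℕₚ.<⇒≢ j<k (sym (residue-injective k<n (ℕₚ.<-trans j<k k<n) K≈J))

  HT≈HF+K : ∀ t → HT.term t ≈ HF.term t + K
  HT≈HF+K t = ≈-reflexive (shift K (+ t * Δ))
    where
    shift : ∀ x a → x + a ≡ 0ℤ + a + x
    shift x a = solve (x ∷ a ∷ [])

  HT≈HF[1+]+J : ∀ t → HT.term t ≈ HF.term (suc t) + J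
  HT≈HF[1+]+J t = begin
    K + + t * Δ            ≡⟨ cong (_+ + t * Δ) K≡J+Δ ⟩
    J + Δ + + t * Δ        ≡⟨ shift J Δ (+ t * Δ) ⟩
    0ℤ + + t * Δ + Δ + J   ≡⟨ cong (_+ J) (HF.term-suc t) ⟨
    HF.term (suc t) + J    ∎
    where
    shift : ∀ x d a → x + d + a ≡ 0ℤ + a + d + x
    shift x d a = solve (x ∷ d ∷ a ∷ [])

  BT≈BT[1+]+I : ∀ t → BT.term t ≈ BT.term (suc t) + I
  BT≈BT[1+]+I t = ≈-reflexive (trans (undo (BT.term t) I) (cong (_+ I) (sym (BT.term-suc t))))
    where
    undo : ∀ x y → x ≡ x + - y + y
    undo x y = solve (x ∷ y ∷ [])

  BF-0 : BF.term 0 ≈ I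
  BF-0 = ≈-reflexive (ℤₚ.+-identityʳ I)

  BT-0 : BT.term 0 ≈ J
  BT-0 = ≈-reflexive (ℤₚ.+-identityʳ J)

  BF-last : BF.term n₁ ≈ 0ℤ
  BF-last = ≈-trans (BF.term-last refl) (≈-reflexive (ℤₚ.+-inverseʳ I))

  BT-last : BT.term n₁ ≈ I + J
  BT-last = ≈-trans (BT.term-last refl)
    (≈-reflexive (trans (cong (_+_ J) (ℤₚ.neg-involutive I)) (ℤₚ.+-comm J I)))

  HT-last : HT.term n₁ ≈ J
  HT-last = ≈-trans (HT.term-last refl) (≈-reflexive (trans (cong (_- Δ) K≡J+Δ) (cancel J Δ)))
    where
    cancel : ∀ x d → x + d - d ≡ x
    cancel x d = solve (x ∷ d ∷ [])

  s-exists : Σ ℕ λ s′ → suc s′ < n × HF.term (suc s′) ≈ I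
  s-exists = positive (HF.term-surjective I)
    where
    positive : (Σ ℕ λ t → t < n × HF.term t ≈ I) → Σ ℕ λ s′ → suc s′ < n × HF.term (suc s′) ≈ I
    positive (zero   , _   , 0≈I) = ⊥-elim (I≉0 (≈-sym 0≈I))
    positive (suc s′ , s<n , s≈I) = s′ , s<n , s≈I

  s′ s : ℕ
  s′ = proj₁ s-exists
  s  = suc s′

  s<n : s < n
  s<n = proj₁ (proj₂ s-exists)

  HF-s : HF.term s ≈ I
  HF-s = proj₂ (proj₂ s-exists)

  HT-s′ : HT.term s′ ≈ I + J
  HT-s′ = ≈-trans (HT≈HF[1+]+J s′) (+-congʳ J HF-s)

  m : ℕ
  m = s ℕ.+ s

  0<m : 0 < m
  0<m = s≤s z≤n

  m≤M : m ≤ M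
  m≤M = subst (m ≤_) (sym M≡n+n₁)
    (ℕₚ.m≤n⇒m≤1+n (ℕₚ.+-mono-≤ (ℕₚ.≤-pred s<n) (ℕₚ.≤-pred s<n)))

  A-last : H.at (mirror m M) ≡ hT n₁
  A-last = trans (cong H.at (trans (mirror-upper m≤M) M≡n+n₁)) (H-odd n₁)

  A-first : H.at (mirror m 0) ≡ hT s′
  A-first = trans (cong H.at (trans (mirror-lower 0<m) (ℕₚ.+-suc s′ s′))) (H-odd s′)

  B-last : B.at M ≡ bT n₁
  B-last = trans (cong B.at M≡n+n₁) (B-upper n₁)

  Adj-sym : ∀ g h → Adj g h → Adj h g
  Adj-sym g h = edge⇒adj ∘ Edge-sym ∘ adj⇒edge g h

  H-adjacent : ∀ p → suc p < 2 ℕ.* n → Adj (H.at p) (H.at (suc p))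
  H-adjacent p p+1<2n = alternate-steps (λ _ → Adj) n hF hT
    (λ t _ → edge⇒adj (K-edge (HF.term t) (HT≈HF+K t)))
    (λ t _ → edge⇒adj (Edge-sym (J-edge (HF.term (suc t)) (HT≈HF[1+]+J t))))
    p (subst (suc p <_) 2n≡n+n p+1<2n)

  junction-edge : Edge (hF 0) (hF s)
  junction-edge = α-edge (HF.term 0) (≈-trans HF-s (≈-reflexive (sym (ℤₚ.+-identityˡ I))))

  A-wrap-edge : Edge (hT n₁) (hT s′)
  A-wrap-edge = Edge-sym (α-edgeᵀ (HT.term n₁)
    (≈-trans HT-s′ (≈-trans (≈-reflexive (ℤₚ.+-comm I J)) (+-congʳ I (≈-sym HT-last)))))

  A-adjacent : ∀ p → suc p < 2 ℕ.* n → Adj (H.at (mirror m p)) (H.at (mirror m (suc p)))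
  A-adjacent = reversed-steps Adj Adj-sym 0<m (ℕₚ.m≤n⇒m≤1+n m≤M) H.at
    (λ p p+1<2n _ → H-adjacent p p+1<2n)
    (subst (Adj (H.at 0)) (sym (H-even s)) (edge⇒adj junction-edge))

  A-wrap : Adj (H.at (mirror m M)) (H.at (mirror m 0))
  A-wrap = subst₂ Adj (sym A-last) (sym A-first) (edge⇒adj A-wrap-edge)

  module CycleA = ReversedCycle {Adj = Adj} H m m≤M A-adjacent A-wrap

  B-adjacent : ∀ p → suc p < 2 ℕ.* n → Adj (B.at p) (B.at (suc p))
  B-adjacent p p+1<2n = prefixed-steps Adj n₁ n bF bT
    (λ t _ → edge⇒adj (α-edge (BF.term t) (≈-reflexive (BF.term-suc t))))
    (edge⇒adj (J-edge (BF.term n₁) BT-0≈BF-last+J))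
    (λ t _ → edge⇒adj (α-edgeᵀ (BT.term (suc t)) (BT≈BT[1+]+I t)))
    p (subst (suc p <_) 2n≡n+n p+1<2n)
    where
    BT-0≈BF-last+J : BT.term 0 ≈ BF.term n₁ + J
    BT-0≈BF-last+J =
      ≈-trans BT-0 (≈-trans (≈-reflexive (sym (ℤₚ.+-identityˡ J))) (+-congʳ J (≈-sym BF-last)))

  B-wrap-edge : Edge (bT n₁) (bF 0)
  B-wrap-edge = Edge-sym (J-edge (BF.term 0) (≈-trans BT-last (+-congʳ J (≈-sym BF-0))))

  B-wrap : Adj (B.at M) (B.at 0)
  B-wrap = subst (λ g → Adj g (B.at 0)) (sym B-last) (edge⇒adj B-wrap-edge)

  module CycleB = EnumeratedCycle {Adj = Adj} B B-adjacent B-wrap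

  Pair : D n → D n → D n → D n → Set
  Pair g h u v = (g ≡ u × h ≡ v) ⊎ (g ≡ v × h ≡ u)

  Pair-sym : ∀ {g h u v} → Pair g h u v → Pair h g u v
  Pair-sym (inj₁ (g≡u , h≡v)) = inj₂ (h≡v , g≡u)
  Pair-sym (inj₂ (g≡v , h≡u)) = inj₁ (h≡u , g≡v)

  pair-coordinates : ∀ (v : ℤ → D n) → (∀ {z w} → v z ≡ v w → z ≈ w) → ∀ {z w a b} →
                     Pair (v z) (v w) (v a) (v b) → (z ≈ a × w ≈ b) ⊎ (z ≈ b × w ≈ a)
  pair-coordinates v v-injective (inj₁ (z≡a , w≡b)) = inj₁ (v-injective z≡a , v-injective w≡b)
  pair-coordinates v v-injective (inj₂ (z≡b , w≡a)) = inj₂ (v-injective z≡b , v-injective w≡a)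

  Exchanged : D n → D n → Set
  Exchanged g h = (g ≡ F 0ℤ × h ≡ T J) ⊎ (g ≡ F I × h ≡ T (I + J))

  InA : D n → D n → Set
  InA g@(false , _) h@(false , _) = Pair g h (F 0ℤ) (F I)
  InA g@(true  , _) h@(true  , _) = Pair g h (T J) (T (I + J))
  InA g@(false , _) h@(true  , _) = ¬ Exchanged g h
  InA g@(true  , _) h@(false , _) = ¬ Exchanged h g

  InA-sym : ∀ g h → InA g h → InA h g
  InA-sym (false , _) (false , _) = Pair-sym
  InA-sym (false , _) (true  , _) g-h = g-h
  InA-sym (true  , _) (false , _) g-h = g-h
  InA-sym (true  , _) (true  , _) = Pair-sym

  K-offset-not-J : ∀ {z w} a → w ≈ z + K → z ≈ a → w ≈ a + J → ⊥
  K-offset-not-J {z} {w} a w≈z+K z≈a w≈a+J = K≉J (+-cancelˡ a (begin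
    a + K   ≈⟨ +-congʳ K z≈a ⟨
    z + K   ≈⟨ w≈z+K ⟨
    w       ≈⟨ w≈a+J ⟩
    a + J   ∎))

  H-step-in-A : ∀ p → suc p < 2 ℕ.* n → suc p ≢ m → InA (H.at p) (H.at (suc p))
  H-step-in-A p p+1<2n = alternate-steps (λ p g h → suc p ≢ m → InA g h) n hF hT
    (λ t _ _ → K-step-ordinary t)
    (λ t t+1<n 2t+2≢m → J-step-ordinary t t+1<n 2t+2≢m)
    p (subst (suc p <_) 2n≡n+n p+1<2n)
    where
    K-step-ordinary : ∀ t → ¬ Exchanged (hF t) (hT t)
    K-step-ordinary t (inj₁ (hF≡F0 , hT≡TJ)) =
      K-offset-not-J 0ℤ (HT≈HF+K t) (F-injective (HF.term t) 0ℤ hF≡F0)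
        (≈-trans (T-injective (HT.term t) J hT≡TJ) (≈-reflexive (sym (ℤₚ.+-identityˡ J))))
    K-step-ordinary t (inj₂ (hF≡FI , hT≡TI+J)) =
      K-offset-not-J I (HT≈HF+K t) (F-injective (HF.term t) I hF≡FI) (T-injective (HT.term t) (I + J) hT≡TI+J)

    J-step-ordinary : ∀ t → suc t < n → suc (suc (t ℕ.+ t)) ≢ m → ¬ Exchanged (hF (suc t)) (hT t)
    J-step-ordinary t t+1<n _ (inj₁ (hF≡F0 , _)) =
      ℕₚ.1+n≢0 (HF.term-injective t+1<n (s≤s z≤n) (F-injective (HF.term (suc t)) 0ℤ hF≡F0))
    J-step-ordinary t t+1<n 2t+2≢m (inj₂ (hF≡FI , _)) =
      2t+2≢m (trans (cong suc (sym (ℕₚ.+-suc t t))) (cong (λ u → u ℕ.+ u) t+1≡s))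
      where
      t+1≡s : suc t ≡ s
      t+1≡s = HF.term-injective t+1<n s<n (≈-trans (F-injective (HF.term (suc t)) I hF≡FI) (≈-sym HF-s))

  A-edges-in-A : ∀ {g h} → EdgeOf CycleA.cycle g h → InA g h
  A-edges-in-A = CycleA.edges-satisfy InA InA-sym
    (reversed-steps InA InA-sym 0<m (ℕₚ.m≤n⇒m≤1+n m≤M) H.at H-step-in-A
      (subst (InA (H.at 0)) (sym (H-even s)) (inj₁ (refl , F-cong HF-s))))
    (subst₂ InA (sym A-last) (sym A-first) (inj₁ (T-cong HT-last , T-cong HT-s′)))

  B-step-not-in-A : ∀ p → suc p < 2 ℕ.* n → ¬ InA (B.at p) (B.at (suc p))
  B-step-not-in-A p p+1<2n = prefixed-steps (λ g h → ¬ InA g h) n₁ n bF bT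
    (λ t t+1<n → BF.only-wrap-joins refl 3≤n t+1<n ∘ lower-pair t)
    (λ ¬exceptional → ¬exceptional (inj₁ (F-cong BF-last , T-cong BT-0)))
    (λ t t+1<n → BT.only-wrap-joins refl 3≤n t+1<n ∘ upper-pair t)
    p (subst (suc p <_) 2n≡n+n p+1<2n)
    where
    lower-pair : ∀ t → InA (bF t) (bF (suc t)) →
                 (BF.term t ≈ BF.term n₁ × BF.term (suc t) ≈ BF.term 0) ⊎
                 (BF.term t ≈ BF.term 0 × BF.term (suc t) ≈ BF.term n₁)
    lower-pair t in-A with pair-coordinates F (F-injective _ _) in-A
    ... | inj₁ (t≈0 , t+1≈I) = inj₁ (≈-trans t≈0 (≈-sym BF-last) , ≈-trans t+1≈I (≈-sym BF-0))
    ... | inj₂ (t≈I , t+1≈0) = inj₂ (≈-trans t≈I (≈-sym BF-0) , ≈-trans t+1≈0 (≈-sym BF-last))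

    upper-pair : ∀ t → InA (bT t) (bT (suc t)) →
                 (BT.term t ≈ BT.term n₁ × BT.term (suc t) ≈ BT.term 0) ⊎
                 (BT.term t ≈ BT.term 0 × BT.term (suc t) ≈ BT.term n₁)
    upper-pair t in-A with pair-coordinates T (T-injective _ _) in-A
    ... | inj₁ (t≈J , t+1≈I+J) = inj₂ (≈-trans t≈J (≈-sym BT-0) , ≈-trans t+1≈I+J (≈-sym BT-last))
    ... | inj₂ (t≈I+J , t+1≈J) = inj₁ (≈-trans t≈I+J (≈-sym BT-last) , ≈-trans t+1≈J (≈-sym BT-0))

  B-edges-not-in-A : ∀ {g h} → EdgeOf CycleB.cycle g h → ¬ InA g h
  B-edges-not-in-A = CycleB.edges-satisfy (λ g h → ¬ InA g h) (λ g h ¬g-h h-g → ¬g-h (InA-sym h g h-g))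
    B-step-not-in-A
    (subst (λ g → ¬ InA g (B.at 0)) (sym B-last)
      (λ ¬exceptional → ¬exceptional (inj₂ (F-cong BF-0 , T-cong BT-last))))

  Covered : D n → D n → Set
  Covered g h = EdgeOf CycleA.cycle g h ⊎ EdgeOf CycleB.cycle g h

  Covered-sym : ∀ {g h} → Covered g h → Covered h g
  Covered-sym (inj₁ e) = inj₁ (EdgeOf-sym {C = CycleA.cycle} e)
  Covered-sym (inj₂ e) = inj₂ (EdgeOf-sym {C = CycleB.cycle} e)

  cover-α : ∀ z {w} → w ≈ z + I → Covered (F z) (F w)
  cover-α z {w} w≈z+I = cases (≈-dec z 0ℤ) (BF.term-surjective z)
    where
    cases : Dec (z ≈ 0ℤ) → (Σ ℕ λ t → t < n × BF.term t ≈ z) → Covered (F z) (F w)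
    cases (yes z≈0) _ = inj₁ (subst₂ (EdgeOf CycleA.cycle) (F-cong (≈-sym z≈0))
                          (trans (H-even s) (F-cong HF-s≈w)) (CycleA.junction-edge 0<m))
      where
      HF-s≈w : HF.term s ≈ w
      HF-s≈w = ≈-trans HF-s (≈-trans (≈-reflexive (sym (ℤₚ.+-identityˡ I)))
                 (≈-trans (+-congʳ I (≈-sym z≈0)) (≈-sym w≈z+I)))
    cases (no z≉0) (t , t<n , BF-t≈z) = inj₂ (subst₂ (EdgeOf CycleB.cycle)
      (trans (B-lower t<n) (F-cong BF-t≈z)) (trans (B-lower t+1<n) (F-cong BF-t+1≈w))
      (CycleB.step-edge (lower-half t+1<n)))
      where
      t+1<n : suc t < n
      t+1<n = below-last t<n λ t≡n₁ →
        z≉0 (≈-trans (≈-sym BF-t≈z) (subst (λ u → BF.term u ≈ 0ℤ) (sym t≡n₁) BF-last))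
      BF-t+1≈w : BF.term (suc t) ≈ w
      BF-t+1≈w = ≈-trans (≈-reflexive (BF.term-suc t)) (≈-trans (+-congʳ I BF-t≈z) (≈-sym w≈z+I))

  cover-αᵀ : ∀ {z} w → z ≈ w + I → Covered (T z) (T w)
  cover-αᵀ {z} w z≈w+I = cases (≈-dec w J) (BT.term-surjective z)
    where
    cases : Dec (w ≈ J) → (Σ ℕ λ t → t < n × BT.term t ≈ z) → Covered (T z) (T w)
    cases (yes w≈J) _ = inj₁ (EdgeOf-sym {C = CycleA.cycle} (subst₂ (EdgeOf CycleA.cycle)
      (trans A-last (T-cong HT-n₁≈w)) (trans A-first (T-cong HT-s′≈z)) CycleA.wrap-edge))
      where
      HT-n₁≈w : HT.term n₁ ≈ w
      HT-n₁≈w = ≈-trans HT-last (≈-sym w≈J)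
      HT-s′≈z : HT.term s′ ≈ z
      HT-s′≈z = ≈-trans HT-s′ (≈-trans (≈-reflexive (ℤₚ.+-comm I J))
                  (≈-trans (+-congʳ I (≈-sym w≈J)) (≈-sym z≈w+I)))
    cases (no w≉J) (t , t<n , BT-t≈z) = inj₂ (subst₂ (EdgeOf CycleB.cycle)
      (trans (B-upper t) (T-cong BT-t≈z))
      (trans (cong B.at (sym (ℕₚ.+-suc n t))) (trans (B-upper (suc t)) (T-cong BT-t+1≈w)))
      (CycleB.step-edge (subst (_< 2 ℕ.* n) (ℕₚ.+-suc n t) (upper-half t+1<n))))
      where
      BT-t+1≈w : BT.term (suc t) ≈ w
      BT-t+1≈w = +-cancelʳ I (≈-trans (≈-sym (BT≈BT[1+]+I t)) (≈-trans BT-t≈z z≈w+I))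
      t+1<n : suc t < n
      t+1<n = below-last t<n λ t≡n₁ → w≉J (+-cancelʳ I (begin
        w + I        ≈⟨ z≈w+I ⟨
        z            ≈⟨ BT-t≈z ⟨
        BT.term t    ≡⟨ cong BT.term t≡n₁ ⟩
        BT.term n₁   ≈⟨ BT-last ⟩
        I + J        ≡⟨ ℤₚ.+-comm I J ⟩
        J + I        ∎))

  cover-J : ∀ z {w} → w ≈ z + J → Covered (F z) (T w)
  cover-J z {w} w≈z+J = cases (≈-dec z 0ℤ) (≈-dec z I) (HT.term-surjective w)
    where
    cases : Dec (z ≈ 0ℤ) → Dec (z ≈ I) → (Σ ℕ λ t → t < n × HT.term t ≈ w) → Covered (F z) (T w)
    cases (yes z≈0) _ _ = inj₂ (subst₂ (EdgeOf CycleB.cycle)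
      (trans (B-lower ℕₚ.≤-refl) (F-cong BF-n₁≈z))
      (trans (cong B.at (sym (ℕₚ.+-identityʳ n))) (trans (B-upper 0) (T-cong BT-0≈w)))
      (CycleB.step-edge {n₁} (ℕₚ.m<m+n n (s≤s z≤n))))
      where
      BF-n₁≈z : BF.term n₁ ≈ z
      BF-n₁≈z = ≈-trans BF-last (≈-sym z≈0)
      BT-0≈w : BT.term 0 ≈ w
      BT-0≈w = ≈-trans BT-0 (≈-trans (≈-reflexive (sym (ℤₚ.+-identityˡ J)))
                 (≈-trans (+-congʳ J (≈-sym z≈0)) (≈-sym w≈z+J)))
    cases (no _) (yes z≈I) _ = inj₂ (EdgeOf-sym {C = CycleB.cycle} (subst₂ (EdgeOf CycleB.cycle)
      (trans B-last (T-cong BT-n₁≈w)) (F-cong (≈-trans BF-0 (≈-sym z≈I))) CycleB.wrap-edge))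
      where
      BT-n₁≈w : BT.term n₁ ≈ w
      BT-n₁≈w = ≈-trans BT-last (≈-trans (+-congʳ J (≈-sym z≈I)) (≈-sym w≈z+J))
    cases (no z≉0) (no z≉I) (t , t<n , HT-t≈w) = inj₁ (EdgeOf-sym {C = CycleA.cycle}
      (subst₂ (EdgeOf CycleA.cycle) (trans (H-odd t) (T-cong HT-t≈w))
        (trans (cong H.at 2t+2≡) (trans (H-even (suc t)) (F-cong HF-t+1≈z)))
        (CycleA.unreversed-edge (subst (_< 2 ℕ.* n) (sym 2t+2≡) 2t+2<2n) 2t+2≢m)))
      where
      2t+2≡ : suc (suc (t ℕ.+ t)) ≡ suc t ℕ.+ suc t
      2t+2≡ = cong suc (sym (ℕₚ.+-suc t t))
      HF-t+1≈z : HF.term (suc t) ≈ z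
      HF-t+1≈z = +-cancelʳ J (≈-trans (≈-sym (HT≈HF[1+]+J t)) (≈-trans HT-t≈w w≈z+J))
      t+1<n : suc t < n
      t+1<n = below-last t<n λ t≡n₁ → z≉0 (+-cancelʳ J (begin
        z + J        ≈⟨ w≈z+J ⟨
        w            ≈⟨ HT-t≈w ⟨
        HT.term t    ≡⟨ cong HT.term t≡n₁ ⟩
        HT.term n₁   ≈⟨ HT-last ⟩
        J            ≡⟨ ℤₚ.+-identityˡ J ⟨
        0ℤ + J       ∎))
      2t+2<2n : suc t ℕ.+ suc t < 2 ℕ.* n
      2t+2<2n = ℕₚ.<-trans (ℕₚ.n<1+n _) (odd-position t+1<n)
      2t+2≢m : suc (suc (t ℕ.+ t)) ≢ m
      2t+2≢m 2t+2≡m = z≉I (begin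
        z                ≈⟨ HF-t+1≈z ⟨
        HF.term (suc t)  ≡⟨ cong HF.term (double-injective (suc t) s (trans (sym 2t+2≡) 2t+2≡m)) ⟩
        HF.term s        ≈⟨ HF-s ⟩
        I                ∎)

  cover-K : ∀ z {w} → w ≈ z + K → Covered (F z) (T w)
  cover-K z {w} w≈z+K = position (HF.term-surjective z)
    where
    position : (Σ ℕ λ t → t < n × HF.term t ≈ z) → Covered (F z) (T w)
    position (t , t<n , HF-t≈z) = inj₁ (subst₂ (EdgeOf CycleA.cycle)
      (trans (H-even t) (F-cong HF-t≈z)) (trans (H-odd t) (T-cong HT-t≈w))
      (CycleA.unreversed-edge (odd-position t<n) (λ 2t+1≡m → even≢odd s t (sym 2t+1≡m))))
      where
      HT-t≈w : HT.term t ≈ w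
      HT-t≈w = ≈-trans (HT≈HF+K t) (≈-trans (+-congʳ K HF-t≈z) (≈-sym w≈z+K))

  cover-coordinates : ∀ b c z w → Edge (b , [ z ]) (c , [ w ]) → Covered (b , [ z ]) (c , [ w ])
  cover-coordinates false false z w e =
    [ cover-α z , (λ z≈w+I → Covered-sym (cover-α w z≈w+I)) ]′ (α-edge-cases z w e)
  cover-coordinates true  true  z w e =
    [ cover-αᵀ w , (λ w≈z+I → Covered-sym (cover-αᵀ z w≈z+I)) ]′ (α-edgeᵀ-cases z w e)
  cover-coordinates false true  z w e = [ cover-J z , cover-K z ]′ (β-edge-cases z w e)
  cover-coordinates true  false z w e = Covered-sym (cover-coordinates false true w z (Edge-sym e))

  cover : ∀ g h → Adj g h → Covered g h
  cover (b , a) (c , x) adj = subst₂ Covered (vertex-⟦⟧ b a) (vertex-⟦⟧ c x)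
    (cover-coordinates b c ⟦ a ⟧ ⟦ x ⟧
      (subst₂ Edge (sym (vertex-⟦⟧ b a)) (sym (vertex-⟦⟧ c x)) (adj⇒edge _ _ adj)))

  decomposition : HamiltonDecomposition₂ (2 ℕ.* n) Adj
  decomposition = CycleA.cycle , CycleB.cycle , λ g h adj →
    cover g h adj , λ (in-A , in-B) → B-edges-not-in-A in-B (A-edges-in-A in-A)

open import Data.Nat using (_≤_; _<_; _∸_; _*_)

lemma3 : (n : ℕ) .{{_ : NonZero n}} → 3 ≤ n →
         (i j k : ℕ) → 1 ≤ i → i ≤ n ∸ 1 → 1 ≤ j → j < k → k ≤ n ∸ 1 →
         gcd i n ≡ 1 → gcd (k ∸ j) n ≡ 1 →
         HamiltonDecomposition₂ (2 * n) (CayAdj {n} i j k)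
lemma3 (suc n₁) 3≤n i j k 1≤i i≤n₁ _ j<k k≤n₁ gcd[i,n]≡1 gcd[k-j,n]≡1 =
  Decomposition.decomposition n₁ i j k 3≤n 1≤i (s≤s i≤n₁) j<k (s≤s k≤n₁) gcd[i,n]≡1 gcd[k-j,n]≡1
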